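{- Let $G$ be a semicomplete digraph on $n$ vertices. Then for every pair $d_1,d_2$ of nonnegative integers with $d_1+d_2<n$, we have $|V^+_{\ge d_1}(G)\cap V^-_{\ge d_2}(G)|\le n-(d_1+d_2)+2\,{\rm pw}(G)$.
   Context: Digraphs are simple; $G$ is semicomplete if between every two distinct vertices there is at least one edge. $d^+(v)=|N^+(v)|$ and $d^-(v)=|N^-(v)|$ are the numbers of out- and in-neighbors. $V^+_{\ge d}(G)$ is the set of vertices $v$ with $d^+(v)\ge d$ and $V^-_{\ge d}(G)$ the set with $d^-(v)\ge d$. A path-decomposition of $G$ is a sequence $(X_1,\dots,X_m)$ of subsets of $V(G)$ with $\bigcup_iX_i=V(G)$, such that for each edge $(u,v)$ there are $i\ge j$ with $u\in X_i$, $v\in X_j$, and for each vertex $v$ the set $\{i:v\in X_i\}$ is an integer interval; width is $\max_i|X_i|-1$; ${\rm pw}(G)$ is the minimum width. -}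

module Defs where

open import Data.Nat using (ℕ; _≤_; _≥_; _+_; suc)
open import Data.Fin using (Fin)
import Data.Fin as F
open import Data.Fin.Subset using (Subset; _∈_; ∣_∣)
open import Data.List using (List; length; filter; allFin)
open import Data.Product using (Σ; ∃; _×_; _,_)
open import Data.Sum using (_⊎_)
open import Relation.Nullary using (¬_; Dec)
open import Relation.Nullary.Decidable using (_×-dec_)
open import Relation.Unary using (Decidable)
open import Relation.Binary.PropositionalEquality using (_≡_)
open import Data.Nat.Properties using (_≥?_)

-- A simple digraph on vertex set Fin n: a decidable edge relation with no loops.
-- (Simplicity: no loops, no parallel edges -- the latter is automatic for a relation;
-- edges u→v and v→u may both be present.)
record Digraph (n : ℕ) : Set₁ where
  field
    Edge      : Fin n → Fin n → Set
    edge?     : (u v : Fin n) → Dec (Edge u v)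
    irreflexive : (v : Fin n) → ¬ Edge v v
open Digraph public

Semicomplete : ∀ {n} → Digraph n → Set
Semicomplete {n} G = (u v : Fin n) → ¬ u ≡ v → Edge G u v ⊎ Edge G v u

outNbrs : ∀ {n} → Digraph n → Fin n → List (Fin n)
outNbrs {n} G v = filter (λ w → edge? G v w) (allFin n)

inNbrs : ∀ {n} → Digraph n → Fin n → List (Fin n)
inNbrs {n} G v = filter (λ w → edge? G w v) (allFin n)

outdeg : ∀ {n} → Digraph n → Fin n → ℕ
outdeg G v = length (outNbrs G v)

indeg : ∀ {n} → Digraph n → Fin n → ℕ
indeg G v = length (inNbrs G v)

countHighDeg : ∀ {n} → Digraph n → ℕ → ℕ → ℕ
countHighDeg {n} G d₁ d₂ =
  length (filter (λ v → (outdeg G v ≥? d₁) ×-dec (indeg G v ≥? d₂)) (allFin n))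

record PathDecomposition {n : ℕ} (G : Digraph n) : Set where
  field
    len      : ℕ
    bag      : Fin len → Subset n
    covers   : (v : Fin n) → ∃ λ i → v ∈ bag i
    edges    : (u v : Fin n) → Edge G u v →
               ∃ λ i → ∃ λ j → (j F.≤ i) × (u ∈ bag i) × (v ∈ bag j)
    interval : (v : Fin n) (i j k : Fin len) → i F.≤ j → j F.≤ k →
               v ∈ bag i → v ∈ bag k → v ∈ bag j
open PathDecomposition public

-- The decomposition has width at most w, i.e. max_i |X_i| - 1 ≤ w.
WidthAtMost : ∀ {n} {G : Digraph n} → PathDecomposition G → ℕ → Set
WidthAtMost D w = ∀ i → ∣ bag D i ∣ ≤ suc w

IsPathwidth : ∀ {n} → Digraph n → ℕ → Set
IsPathwidth G p =
  (Σ (PathDecomposition G) λ D → WidthAtMost D p) ×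
  (∀ (D : PathDecomposition G) (w : ℕ) → WidthAtMost D w → p ≤ w)

-- Fix a path-decomposition (X₀,…,X_m) of width p. Let a be the first index such that more
-- than d₁ vertices occur in X₀,…,X_a, and b the last index such that more than d₂ vertices
-- occur in X_b,…,X_m; since d₁ + d₂ < n, a ≤ b. A vertex of out-degree at least d₁ cannot
-- occur only in bags before X_a, for then its out-neighbours and itself would be among the
-- at most d₁ vertices occurring before X_a. Dually, a vertex of in-degree at least d₂ occurs
-- in some bag up to X_b. So the high-degree vertices, the vertices occurring only before X_a
-- and those occurring only after X_b are pairwise disjoint. By the interval property the
-- second set misses at most the p + 1 vertices of X_a among those occurring in X₀,…,X_a,
-- so it has at least d₁ − p elements; likewise the third has at least d₂ − p.
module Submission where

open import Data.Empty using (⊥-elim)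
open import Data.Fin using (Fin; suc; toℕ; fromℕ<)
open import Data.Fin.Properties using (any?; toℕ-fromℕ<; fromℕ<-toℕ; toℕ<n)
open import Data.Fin.Subset using (Subset; _∈_; ∣_∣; inside; outside)
open import Data.Fin.Subset.Properties using (_∈?_; drop-there)
open import Data.List using (List; []; _∷_; length; filter; map; tabulate; allFin)
open import Data.List.Properties using (length-filter; filter-all; filter-none; filter-≐; length-tabulate; map-tabulate)
open import Data.List.Membership.Propositional using () renaming (_∈_ to _∈ˡ_)
open import Data.List.Membership.Propositional.Properties using (∈-allFin)
import Data.List.Relation.Unary.All as All
open import Data.List.Relation.Unary.Any using (here; there)
open import Data.Nat using (ℕ; zero; suc; _+_; _*_; _≤_; _<_; _≥_; z≤n; s≤s; s≤s⁻¹; _<?_; _≤?_)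
open import Data.Nat.Properties
open import Data.Nat.Tactic.RingSolver using (solve-∀)
open import Data.Product using (_,_; _×_; ∃-syntax)
open import Data.Sum using (_⊎_; inj₁; inj₂)
open import Data.Vec using ([]; _∷_)
import Data.Vec as Vec
open import Function using (id)
open import Level using (0ℓ)
open import Relation.Binary.PropositionalEquality using (_≡_; refl; sym; trans; cong; subst; module ≡-Reasoning)
open import Relation.Nullary using (¬_; yes; no)
open import Relation.Nullary.Decidable using (_×-dec_; decidable-stable)
open import Relation.Unary using (Pred; Decidable; _⊆_; _∪_; ∁)
open import Relation.Unary.Properties using (_∪?_; _∩?_; ∁?)

open import Defs

count : ∀ {a p} {A : Set a} {P : Pred A p} → Decidable P → List A → ℕ
count P? xs = length (filter P? xs)

module _ {a} {A : Set a} where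

  module _ {p q} {P : Pred A p} {Q : Pred A q} (P? : Decidable P) (Q? : Decidable Q) where

    count-mono : P ⊆ Q → ∀ xs → count P? xs ≤ count Q? xs
    count-mono P⊆Q [] = z≤n
    count-mono P⊆Q (x ∷ xs) with P? x | Q? x
    ... | yes px | no ¬qx = ⊥-elim (¬qx (P⊆Q px))
    ... | yes _  | yes _  = s≤s (count-mono P⊆Q xs)
    ... | no _   | yes _  = m≤n⇒m≤1+n (count-mono P⊆Q xs)
    ... | no _   | no _   = count-mono P⊆Q xs

    count-< : P ⊆ Q → ∀ {x xs} → x ∈ˡ xs → Q x → ¬ P x → count P? xs < count Q? xs
    count-< P⊆Q {x} {xs = _ ∷ xs} (here refl) qx ¬px with P? x | Q? x
    ... | yes px | _     = ⊥-elim (¬px px)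
    ... | no _  | no ¬qx = ⊥-elim (¬qx qx)
    ... | no _  | yes _  = s≤s (count-mono P⊆Q xs)
    count-< P⊆Q {xs = y ∷ xs} (there x∈xs) qx ¬px with P? y | Q? y
    ... | yes py | no ¬qy = ⊥-elim (¬qy (P⊆Q py))
    ... | yes _  | yes _  = s≤s (count-< P⊆Q x∈xs qx ¬px)
    ... | no _   | yes _  = m<n⇒m<1+n (count-< P⊆Q x∈xs qx ¬px)
    ... | no _   | no _   = count-< P⊆Q x∈xs qx ¬px

  module _ {p q} {P : Pred A p} {Q : Pred A q} (P? : Decidable P) (Q? : Decidable Q) where

    count-∪+count-∩ : ∀ xs → count (P? ∪? Q?) xs + count (P? ∩? Q?) xs ≡ count P? xs + count Q? xs
    count-∪+count-∩ [] = refl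
    count-∪+count-∩ (x ∷ xs) with ih ← count-∪+count-∩ xs | P? x | Q? x
    ... | yes _ | yes _ = cong suc (trans (+-suc _ _) (trans (cong suc ih) (sym (+-suc _ _))))
    ... | yes _ | no _  = cong suc ih
    ... | no _  | yes _ = trans (cong suc ih) (sym (+-suc _ _))
    ... | no _  | no _  = ih

    count-≤-∪ : ∀ {r} {R : Pred A r} (R? : Decidable R) → R ⊆ P ∪ Q →
                ∀ xs → count R? xs ≤ count P? xs + count Q? xs
    count-≤-∪ R? R⊆P∪Q xs = begin
      count R? xs                                       ≤⟨ count-mono R? (P? ∪? Q?) R⊆P∪Q xs ⟩
      count (P? ∪? Q?) xs                               ≤⟨ m≤m+n _ _ ⟩
      count (P? ∪? Q?) xs + count (P? ∩? Q?) xs         ≡⟨ count-∪+count-∩ xs ⟩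
      count P? xs + count Q? xs                         ∎
      where open ≤-Reasoning

    count-disjoint : ∀ {r} {R : Pred A r} (R? : Decidable R) → (∀ {x} → P x → ¬ Q x) →
                     P ∪ Q ⊆ R → ∀ xs → count P? xs + count Q? xs ≤ count R? xs
    count-disjoint R? P∩Q=∅ P∪Q⊆R xs = begin
      count P? xs + count Q? xs                         ≡⟨ count-∪+count-∩ xs ⟨
      count (P? ∪? Q?) xs + count (P? ∩? Q?) xs         ≡⟨ cong (count (P? ∪? Q?) xs +_) (cong length ∩-empty) ⟩
      count (P? ∪? Q?) xs + 0                           ≡⟨ +-identityʳ _ ⟩
      count (P? ∪? Q?) xs                               ≤⟨ count-mono (P? ∪? Q?) R? P∪Q⊆R xs ⟩
      count R? xs                                       ∎
      where
      open ≤-Reasoning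
      ∩-empty : filter (P? ∩? Q?) xs ≡ []
      ∩-empty = filter-none (P? ∩? Q?) (All.universal (λ _ (px , qx) → P∩Q=∅ px qx) xs)

  count-map : ∀ {b p} {B : Set b} {P : Pred B p} (P? : Decidable P) (f : A → B) →
              ∀ xs → count P? (map f xs) ≡ count (λ x → P? (f x)) xs
  count-map P? f [] = refl
  count-map P? f (x ∷ xs) with P? (f x)
  ... | yes _ = cong suc (count-map P? f xs)
  ... | no _  = count-map P? f xs

card : ∀ {n p} {P : Pred (Fin n) p} → Decidable P → ℕ
card {n} P? = count P? (allFin n)

module _ {n p} {P : Pred (Fin n) p} (P? : Decidable P) where

  card≤n : card P? ≤ n
  card≤n = ≤-trans (length-filter P? (allFin n)) (≤-reflexive (length-tabulate id))

  card-universal : (∀ v → P v) → card P? ≡ n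
  card-universal all = trans (cong length (filter-all P? (All.universal all (allFin n)))) (length-tabulate id)

  card-empty : (∀ v → ¬ P v) → card P? ≡ 0
  card-empty none = cong length (filter-none P? (All.universal none (allFin n)))

count-∈-suc : ∀ {n} x (s : Subset n) → count (_∈? x ∷ s) (tabulate suc) ≡ card (_∈? s)
count-∈-suc {n} x s = begin
  count (_∈? x ∷ s) (tabulate suc)         ≡⟨ cong (count (_∈? x ∷ s)) (map-tabulate id suc) ⟨
  count (_∈? x ∷ s) (map suc (allFin n))   ≡⟨ count-map (_∈? x ∷ s) suc (allFin n) ⟩
  count (λ v → suc v ∈? x ∷ s) (allFin n)  ≡⟨ cong length (filter-≐ _ (_∈? s) (drop-there , Vec.there) (allFin n)) ⟩
  card (_∈? s)                             ∎
  where open ≡-Reasoning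

card-∈ : ∀ {n} (s : Subset n) → card (_∈? s) ≡ ∣ s ∣
card-∈ []           = refl
card-∈ (inside ∷ s)  = cong suc (trans (count-∈-suc inside s) (card-∈ s))
card-∈ (outside ∷ s) = trans (count-∈-suc outside s) (card-∈ s)

boundary : ∀ {p} {P : Pred ℕ p} → Decidable P → ¬ P 0 → ∀ {m} → P m → ∃[ k ] ¬ P k × P (suc k)
boundary P? ¬P0 {zero}  P0   = ⊥-elim (¬P0 P0)
boundary P? ¬P0 {suc m} Pm+1 with P? m
... | yes Pm  = boundary P? ¬P0 Pm
... | no  ¬Pm = m , ¬Pm , Pm+1

module _ {n} {G : Digraph n} (D : PathDecomposition G) where

  InBagBefore InBagFrom InBagAt : ℕ → Pred (Fin n) 0ℓ
  InBagBefore t v = ∃[ i ] toℕ i < t × v ∈ bag D i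
  InBagFrom   t v = ∃[ i ] t ≤ toℕ i × v ∈ bag D i
  InBagAt     t v = ∃[ i ] toℕ i ≡ t × v ∈ bag D i

  inBagBefore? : ∀ t → Decidable (InBagBefore t)
  inBagBefore? t v = any? λ i → (toℕ i <? t) ×-dec (v ∈? bag D i)

  inBagFrom? : ∀ t → Decidable (InBagFrom t)
  inBagFrom? t v = any? λ i → (t ≤? toℕ i) ×-dec (v ∈? bag D i)

  inBagAt? : ∀ t → Decidable (InBagAt t)
  inBagAt? t v = any? λ i → (toℕ i ≟ t) ×-dec (v ∈? bag D i)

  before-or-from : ∀ {s t} → s ≤ t → ∀ v → InBagBefore t v ⊎ InBagFrom s v
  before-or-from {s} {t} s≤t v with covers D v
  ... | i , v∈i with toℕ i <? t
  ...   | yes i<t = inj₁ (i , i<t , v∈i)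
  ...   | no  i≮t = inj₂ (i , ≤-trans s≤t (≮⇒≥ i≮t) , v∈i)

  before∧from⇒at : ∀ {t v} → InBagBefore (suc t) v → InBagFrom t v → InBagAt t v
  before∧from⇒at {t} {v} (i , i<1+t , v∈i) (k , t≤k , v∈k) =
    j , toℕ-fromℕ< t<len , interval D v i j k i≤j j≤k v∈i v∈k
    where
    t<len = ≤-<-trans t≤k (toℕ<n k)
    j = fromℕ< t<len
    i≤j : toℕ i ≤ toℕ j
    i≤j = subst (toℕ i ≤_) (sym (toℕ-fromℕ< t<len)) (s≤s⁻¹ i<1+t)
    j≤k : toℕ j ≤ toℕ k
    j≤k = subst (_≤ toℕ k) (sym (toℕ-fromℕ< t<len)) t≤k

  card-before-0 : card (inBagBefore? 0) ≡ 0
  card-before-0 = card-empty (inBagBefore? 0) λ { _ (_ , () , _) }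

  card-before-len : card (inBagBefore? (len D)) ≡ n
  card-before-len = card-universal (inBagBefore? (len D)) λ v →
    let (i , v∈i) = covers D v in i , toℕ<n i , v∈i

  card-from-0 : card (inBagFrom? 0) ≡ n
  card-from-0 = card-universal (inBagFrom? 0) λ v →
    let (i , v∈i) = covers D v in i , z≤n , v∈i

  card-from-len : card (inBagFrom? (len D)) ≡ 0
  card-from-len = card-empty (inBagFrom? (len D)) λ { _ (i , len≤i , _) → <⇒≱ (toℕ<n i) len≤i }

  card-at≤ : ∀ {w} → WidthAtMost D w → ∀ t → card (inBagAt? t) ≤ suc w
  card-at≤ {w} width t with t <? len D
  ... | yes t<len = begin
    card (inBagAt? t)      ≤⟨ count-mono (inBagAt? t) (_∈? bag D j) at⊆j (allFin n) ⟩
    card (_∈? bag D j)     ≡⟨ card-∈ (bag D j) ⟩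
    ∣ bag D j ∣            ≤⟨ width j ⟩
    suc w                  ∎
    where
    open ≤-Reasoning
    j = fromℕ< t<len
    at⊆j : InBagAt t ⊆ (_∈ bag D j)
    at⊆j (i , refl , v∈i) = subst (λ k → _ ∈ bag D k) (sym (fromℕ<-toℕ i t<len)) v∈i
  ... | no t≮len = ≤-trans (≤-reflexive (card-empty (inBagAt? t) λ { _ (i , refl , _) → t≮len (toℕ<n i) })) z≤n

  card-before-suc≤ : ∀ t → card (inBagBefore? (suc t)) ≤ card (∁? (inBagFrom? t)) + card (inBagAt? t)
  card-before-suc≤ t = count-≤-∪ (∁? (inBagFrom? t)) (inBagAt? t) (inBagBefore? (suc t)) split (allFin n)
    where
    split : InBagBefore (suc t) ⊆ ∁ (InBagFrom t) ∪ InBagAt t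
    split {v} before with inBagFrom? t v
    ... | yes from = inj₂ (before∧from⇒at before from)
    ... | no ¬from = inj₁ ¬from

  card-from≤ : ∀ t → card (inBagFrom? t) ≤ card (∁? (inBagBefore? (suc t))) + card (inBagAt? t)
  card-from≤ t = count-≤-∪ (∁? (inBagBefore? (suc t))) (inBagAt? t) (inBagFrom? t) split (allFin n)
    where
    split : InBagFrom t ⊆ ∁ (InBagBefore (suc t)) ∪ InBagAt t
    split {v} from with inBagBefore? (suc t) v
    ... | yes before = inj₂ (before∧from⇒at before from)
    ... | no ¬before = inj₁ ¬before

  outdeg<card-before : ∀ {t v} → ¬ InBagFrom t v → outdeg G v < card (inBagBefore? t)
  outdeg<card-before {t} {v} ¬from =
    count-< (edge? G v) (inBagBefore? t) out⊆before (∈-allFin v) v-before (irreflexive G v)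
    where
    bags-before : ∀ {i} → v ∈ bag D i → toℕ i < t
    bags-before {i} v∈i = ≰⇒> λ t≤i → ¬from (i , t≤i , v∈i)
    out⊆before : Edge G v ⊆ InBagBefore t
    out⊆before {u} v→u with edges D v u v→u
    ... | i , j , j≤i , v∈i , u∈j = j , ≤-<-trans j≤i (bags-before v∈i) , u∈j
    v-before : InBagBefore t v
    v-before = let (i , v∈i) = covers D v in i , bags-before v∈i , v∈i

  indeg<card-from : ∀ {t v} → ¬ InBagBefore t v → indeg G v < card (inBagFrom? t)
  indeg<card-from {t} {v} ¬before =
    count-< (λ u → edge? G u v) (inBagFrom? t) in⊆from (∈-allFin v) v-from (irreflexive G v)
    where
    bags-from : ∀ {j} → v ∈ bag D j → t ≤ toℕ j
    bags-from {j} v∈j = ≮⇒≥ λ j<t → ¬before (j , j<t , v∈j)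
    in⊆from : (λ u → Edge G u v) ⊆ InBagFrom t
    in⊆from {u} u→v with edges D u v u→v
    ... | i , j , j≤i , u∈i , v∈j = i , ≤-trans (bags-from v∈j) j≤i , u∈i
    v-from : InBagFrom t v
    v-from = let (i , v∈i) = covers D v in i , bags-from v∈i , v∈i

module _ {n} {G : Digraph n} (D : PathDecomposition G) {w} (width : WidthAtMost D w) (d₁ d₂ : ℕ) where

  High : Pred (Fin n) 0ℓ
  High v = outdeg G v ≥ d₁ × indeg G v ≥ d₂

  high? : Decidable High
  high? v = (outdeg G v ≥? d₁) ×-dec (indeg G v ≥? d₂)

  high⇒from : ∀ {a} → card (inBagBefore? D a) ≤ d₁ → High ⊆ InBagFrom D a
  high⇒from {a} before≤d₁ {v} (d₁≤out , _) = decidable-stable (inBagFrom? D a v) λ ¬from →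
    <⇒≱ (outdeg<card-before D ¬from) (≤-trans before≤d₁ d₁≤out)

  high⇒before : ∀ {b} → card (inBagFrom? D b) ≤ d₂ → High ⊆ InBagBefore D b
  high⇒before {b} from≤d₂ {v} (_ , d₂≤in) = decidable-stable (inBagBefore? D b v) λ ¬before →
    <⇒≱ (indeg<card-from D ¬before) (≤-trans from≤d₂ d₂≤in)

  thresholds-ordered : ∀ {a b} → d₁ + d₂ < n →
                       card (inBagBefore? D a) ≤ d₁ → card (inBagFrom? D (suc b)) ≤ d₂ → a ≤ b
  thresholds-ordered {a} {b} d₁+d₂<n before≤d₁ from≤d₂ = ≮⇒≥ λ b<a → <⇒≱ d₁+d₂<n (begin
    n                                                       ≡⟨ card-universal covered? (before-or-from D b<a) ⟨
    card covered?                                           ≤⟨ count-≤-∪ (inBagBefore? D a) (inBagFrom? D (suc b)) covered? id (allFin n) ⟩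
    card (inBagBefore? D a) + card (inBagFrom? D (suc b))   ≤⟨ +-mono-≤ before≤d₁ from≤d₂ ⟩
    d₁ + d₂                                                 ∎)
    where
    open ≤-Reasoning
    covered? = inBagBefore? D a ∪? inBagFrom? D (suc b)

  high-degree-bound-at : ∀ {a b} → a ≤ b →
                         card (inBagBefore? D a) ≤ d₁ → d₁ < card (inBagBefore? D (suc a)) →
                         d₂ < card (inBagFrom? D b) → card (inBagFrom? D (suc b)) ≤ d₂ →
                         card high? + (d₁ + d₂) ≤ n + 2 * w
  high-degree-bound-at {a} {b} a≤b before≤d₁ d₁<before d₂<from from≤d₂ = begin
    card high? + (d₁ + d₂)                                ≤⟨ +-monoʳ-≤ (card high?) (+-mono-≤ d₁≤left+w d₂≤right+w) ⟩
    card high? + ((card left? + w) + (card right? + w))   ≡⟨ regroup (card high?) (card left?) (card right?) w ⟩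
    card high? + card left? + card right? + 2 * w         ≤⟨ +-monoˡ-≤ (2 * w) disjoint-sum ⟩
    n + 2 * w                                             ∎
    where
    open ≤-Reasoning
    left?  = ∁? (inBagFrom? D a)
    right? = ∁? (inBagBefore? D (suc b))
    regroup : ∀ h l r w → h + ((l + w) + (r + w)) ≡ h + l + r + 2 * w
    regroup = solve-∀
    d₁≤left+w : d₁ ≤ card left? + w
    d₁≤left+w = s≤s⁻¹ (begin
      suc d₁                                      ≤⟨ d₁<before ⟩
      card (inBagBefore? D (suc a))               ≤⟨ card-before-suc≤ D a ⟩
      card left? + card (inBagAt? D a)            ≤⟨ +-monoʳ-≤ (card left?) (card-at≤ D width a) ⟩
      card left? + suc w                          ≡⟨ +-suc (card left?) w ⟩
      suc (card left? + w)                        ∎)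
    d₂≤right+w : d₂ ≤ card right? + w
    d₂≤right+w = s≤s⁻¹ (begin
      suc d₂                                      ≤⟨ d₂<from ⟩
      card (inBagFrom? D b)                       ≤⟨ card-from≤ D b ⟩
      card right? + card (inBagAt? D b)           ≤⟨ +-monoʳ-≤ (card right?) (card-at≤ D width b) ⟩
      card right? + suc w                         ≡⟨ +-suc (card right?) w ⟩
      suc (card right? + w)                       ∎)
    high∩left=∅ : ∀ {v} → High v → ¬ ∁ (InBagFrom D a) v
    high∩left=∅ h ¬from = ¬from (high⇒from before≤d₁ h)
    high∪left∩right=∅ : ∀ {v} → (High ∪ ∁ (InBagFrom D a)) v → ¬ ∁ (InBagBefore D (suc b)) v
    high∪left∩right=∅ (inj₁ h)     ¬before = ¬before (high⇒before from≤d₂ h)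
    high∪left∩right=∅ {v} (inj₂ ¬from) ¬before with before-or-from D (m≤n⇒m≤1+n a≤b) v
    ... | inj₁ before = ¬before before
    ... | inj₂ from   = ¬from from
    disjoint-sum : card high? + card left? + card right? ≤ n
    disjoint-sum = begin
      card high? + card left? + card right?
        ≤⟨ +-monoˡ-≤ (card right?) (count-disjoint high? left? _ high∩left=∅ id (allFin n)) ⟩
      card (high? ∪? left?) + card right?
        ≤⟨ count-disjoint (high? ∪? left?) right? _ high∪left∩right=∅ id (allFin n) ⟩
      card ((high? ∪? left?) ∪? right?)           ≤⟨ card≤n _ ⟩
      n                                           ∎

  high-degree-bound : d₁ + d₂ < n → card high? + (d₁ + d₂) ≤ n + 2 * w
  high-degree-bound d₁+d₂<n =
    let a , d₁≮before , d₁<before = boundary (λ t → d₁ <? card (inBagBefore? D t)) d₁≮before-0 d₁<before-len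
        b , from≰d₂ , from≤d₂     = boundary (λ t → card (inBagFrom? D t) ≤? d₂) from-0≰d₂ from-len≤d₂
        before≤d₁                 = ≮⇒≥ d₁≮before
    in high-degree-bound-at (thresholds-ordered d₁+d₂<n before≤d₁ from≤d₂) before≤d₁ d₁<before (≰⇒> from≰d₂) from≤d₂
    where
    d₁≮before-0 : ¬ d₁ < card (inBagBefore? D 0)
    d₁≮before-0 rewrite card-before-0 D = λ ()
    d₁<before-len : d₁ < card (inBagBefore? D (len D))
    d₁<before-len rewrite card-before-len D = ≤-<-trans (m≤m+n d₁ d₂) d₁+d₂<n
    from-0≰d₂ : ¬ card (inBagFrom? D 0) ≤ d₂
    from-0≰d₂ rewrite card-from-0 D = <⇒≱ (≤-<-trans (m≤n+m d₂ d₁) d₁+d₂<n)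
    from-len≤d₂ : card (inBagFrom? D (len D)) ≤ d₂
    from-len≤d₂ rewrite card-from-len D = z≤n

lemma10 : ∀ (n : ℕ) (G : Digraph n) → Semicomplete G →
          ∀ (p : ℕ) → IsPathwidth G p →
          ∀ (d₁ d₂ : ℕ) → d₁ + d₂ < n →
          countHighDeg G d₁ d₂ + (d₁ + d₂) ≤ n + 2 * p
lemma10 n G _ p ((D , width) , _) d₁ d₂ = high-degree-bound D width d₁ d₂
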